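{- Let $k\geq 3$ and $2k\leq n-2$, let $G=\operatorname{Sym}(n)$ and $H=\operatorname{Alt}(k)\times\operatorname{Alt}(n-k)$, where $\operatorname{Alt}(k)$ acts on $\{1,\dots,k\}$ and $\operatorname{Alt}(n-k)$ on $\{k+1,\dots,n\}$. For a coset $xH\in G/H$ let $U(xH)=x(\{1,\dots,k\})$ and $\operatorname{sgn}(xH)=\operatorname{sgn}(x)$ (both well defined). Let $\mathcal K(n,k)$ be the graph on $G/H$ in which $xH\sim yH$ iff $U(xH)\cap U(yH)=\varnothing$ and $\operatorname{sgn}(x)=\operatorname{sgn}(y)$. Then $\mathcal K(n,k)$ is isomorphic to the disjoint union of two copies of $K_2\bowtie K(n,k)$.
   Context: $K(n,k)$ is the Kneser graph on $k$-subsets of $[n]$, adjacent iff disjoint. For a graph $Y$, $K_2\bowtie Y$ is the graph with vertex set $\{0,1\}\times V(Y)$ in which $(a,y)\sim(b,y')$ iff $y\sim y'$ in $Y$ (for all $a,b$); equivalently two copies of $Y$ with additional edges as in $K_2\times Y$; its adjacency matrix is $J_2\otimes A(Y)$. $\mathcal K(n,k)$ is an orbital graph of $G$ on $G/H$. -}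

module Defs where

open import Level using (Level; _⊔_; 0ℓ) renaming (suc to lsuc)
open import Data.Nat using (ℕ; zero; suc; _+_; _<ᵇ_)
open import Data.Bool using (Bool; true; false; not; _∧_; if_then_else_)
open import Data.Fin using (Fin; toℕ; _<?_)
import Data.Fin as Fin
open import Data.Fin.Permutation using (Permutation′; _⟨$⟩ʳ_; _⟨$⟩ˡ_; _∘ₚ_; flip)
open import Data.Fin.Subset using (Subset; ∣_∣; _∩_; Empty)
open import Data.Vec using (tabulate)
open import Data.Product using (Σ; _×_; _,_; proj₁; proj₂)
open import Relation.Nullary.Decidable using (⌊_⌋)
open import Relation.Binary.PropositionalEquality using (_≡_)
open import Relation.Binary.Bundles using (Setoid)
open import Relation.Binary.Structures using (IsEquivalence)
open import Function.Bundles using (_⇔_)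

-- Graphs whose vertex set is a setoid (needed because G/H is a quotient)

record Graph (c ℓ r : Level) : Set (lsuc (c ⊔ ℓ ⊔ r)) where
  field
    Vtx   : Set c
    _≈ᵥ_  : Vtx → Vtx → Set ℓ
    Adj   : Vtx → Vtx → Set r

open Graph

record _≅_ {c₁ ℓ₁ r₁ c₂ ℓ₂ r₂} (X : Graph c₁ ℓ₁ r₁) (Y : Graph c₂ ℓ₂ r₂)
       : Set (c₁ ⊔ ℓ₁ ⊔ r₁ ⊔ c₂ ⊔ ℓ₂ ⊔ r₂) where
  field
    to        : Vtx X → Vtx Y
    from      : Vtx Y → Vtx X
    to-cong   : ∀ {x x′} → _≈ᵥ_ X x x′ → _≈ᵥ_ Y (to x) (to x′)
    from-cong : ∀ {y y′} → _≈ᵥ_ Y y y′ → _≈ᵥ_ X (from y) (from y′)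
    from∘to   : ∀ x → _≈ᵥ_ X (from (to x)) x
    to∘from   : ∀ y → _≈ᵥ_ Y (to (from y)) y
    adj⇔      : ∀ x x′ → Adj X x x′ ⇔ Adj Y (to x) (to x′)

K₂⋈ : ∀ {c ℓ r} → Graph c ℓ r → Graph c ℓ r
K₂⋈ Y = record
  { Vtx  = Bool × Vtx Y
  ; _≈ᵥ_ = λ p q → (proj₁ p ≡ proj₁ q) × _≈ᵥ_ Y (proj₂ p) (proj₂ q)
  ; Adj  = λ p q → Adj Y (proj₂ p) (proj₂ q)
  }

TwoCopies : ∀ {c ℓ r} → Graph c ℓ r → Graph c ℓ r
TwoCopies X = record
  { Vtx  = Bool × Vtx X
  ; _≈ᵥ_ = λ p q → (proj₁ p ≡ proj₁ q) × _≈ᵥ_ X (proj₂ p) (proj₂ q)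
  ; Adj  = λ p q → (proj₁ p ≡ proj₁ q) × Adj X (proj₂ p) (proj₂ q)
  }

KneserGraph : ℕ → ℕ → Graph 0ℓ 0ℓ 0ℓ
KneserGraph n k = record
  { Vtx  = Σ (Subset n) (λ p → ∣ p ∣ ≡ k)
  ; _≈ᵥ_ = λ p q → proj₁ p ≡ proj₁ q
  ; Adj  = λ p q → Empty (proj₁ p ∩ proj₁ q)
  }

sumF : ∀ n → (Fin n → ℕ) → ℕ
sumF zero    f = 0
sumF (suc n) f = f Fin.zero + sumF n (λ i → f (Fin.suc i))


even : ℕ → Bool
even zero    = true
even (suc m) = not (even m)

inversionsIn : ∀ {n} → (Fin n → Bool) → Permutation′ n → ℕ
inversionsIn {n} P π = sumF n λ i → sumF n λ j →
  if P i ∧ P j ∧ ⌊ i <? j ⌋ ∧ ⌊ (π ⟨$⟩ʳ j) <? (π ⟨$⟩ʳ i) ⌋ then 1 else 0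

-- sgn π : true = +1 (even), false = -1 (odd)
sgn : ∀ {n} → Permutation′ n → Bool
sgn π = even (inversionsIn (λ _ → true) π)

-- H = Alt(k) × Alt(n-k) ≤ Sym(n) (points 0..k-1 and k..n-1, 0-indexed)

low : ∀ {n} → ℕ → Fin n → Bool
low k i = toℕ i <ᵇ k

InH : ∀ {n} → ℕ → Permutation′ n → Set
InH k π = (∀ i → low k (π ⟨$⟩ʳ i) ≡ low k i)
        × (even (inversionsIn (low k) π) ≡ true)
        × (even (inversionsIn (λ i → not (low k i)) π) ≡ true)

-- xH = yH  iff  x⁻¹ y ∈ H   (y ∘ₚ flip x is  i ↦ x⁻¹ (y i))
SameCoset : ∀ {n} → ℕ → Permutation′ n → Permutation′ n → Set
SameCoset k x y = InH k (y ∘ₚ flip x)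

-- U(xH) = x({1..k})  as a subset: j ∈ U(x) iff x⁻¹ j ∈ {1..k}
U : ∀ {n} → ℕ → Permutation′ n → Subset n
U k x = tabulate (λ j → low k (x ⟨$⟩ˡ j))

-- The graph 𝒦(n,k) on G/H = Sym(n)/H: vertices are represented by
-- permutations x (standing for xH), vertex equality is coset equality,
-- xH ~ yH iff U(xH) ∩ U(yH) = ∅ and sgn x = sgn y.
𝒦 : ℕ → ℕ → Graph 0ℓ 0ℓ 0ℓ
𝒦 n k = record
  { Vtx  = Permutation′ n
  ; _≈ᵥ_ = SameCoset k
  ; Adj  = λ x y → Empty (U k x ∩ U k y) × (sgn x ≡ sgn y)
  }

-- A coset xH of H = Alt(k) × Alt(n − k) is determined by three invariants: U(xH), the sign of x,
-- and the parity of the inversions of x inside the first block {0, …, k − 1}; indeed x⁻¹y ∈ H iff all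
-- three agree. Both parities are additive along permutations h stabilising the block: writing the
-- inversion parity of f as the xor over ascending pairs of "f reverses the pair", the parity of f ∘ h
-- splits as that of h plus that of f reindexed along h, and the xor over ascending pairs of a symmetric
-- relation does not depend on which order decides "ascending". An h stabilising the initial segment
-- inverts no pair straddling it, so its sign is the product of its signs on the two blocks.
-- Composing with a transposition inside either block (both blocks have at least two points) reaches
-- all four parity combinations above every k-set. Hence xH ↦ (sgn x, block parity, U(xH)) identifies
-- 𝒦(n,k) with two copies, indexed by the sign, of K₂ ⋈ K(n,k) with K₂-coordinate the block parity.

module Submission where

open import Defs
open import Algebra.Bundles using (CommutativeRing)
open import Data.Bool using (Bool; true; false; not; _∧_; _xor_; if_then_else_)
open import Data.Bool.Properties
  using (not-involutive; not-injective; not-distribˡ-xor; xor-same; xor-assoc; xor-identityʳ; xor-inverseʳ;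
         xor-annihilates-not;
         ∧-zeroʳ; ∧-identityʳ; ∧-comm; ∧-distribˡ-xor; ∧-distribʳ-xor; xor-∧-commutativeRing)
open import Data.Fin using (Fin; zero; suc; toℕ; fromℕ; punchIn; _↑ʳ_; _<?_)
open import Data.Fin.Properties using (_≟_; toℕ-injective; toℕ-fromℕ)
open import Data.Fin.Patterns using (0F; 1F)
open import Data.Fin.Permutation
  using (Permutation′; _⟨$⟩ʳ_; _⟨$⟩ˡ_; _∘ₚ_; id; flip; inverseˡ; inverseʳ; lift₀; insert; transpose)
open import Data.Nat using (ℕ; zero; suc; _+_; _*_; _<ᵇ_; _≤_; z≤n; s≤s)
open import Data.Nat.Properties
  using (+-0-commutativeMonoid; m≤m+n; ≤-trans; n≤1+n; +-monoˡ-≤; +-assoc; m≤n⇒∃[o]m+o≡n)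
open import Data.Vec using ([]; _∷_; tabulate; lookup)
open import Data.Vec.Properties using (tabulate-cong; tabulate∘lookup; lookup∘tabulate)
open import Data.Fin.Subset using (Subset; ∣_∣)
open import Data.Fin.Subset.Properties using (∣p∣≤n)
open import Function using (_∘_)
open import Function.Bundles using (_⇔_; mk⇔; Equivalence; Injection)
open import Function.Properties.Inverse using (↔⇒↣)
open import Data.Product using (_×_; _,_)
open import Relation.Nullary using (yes; no; contradiction)
open import Relation.Nullary.Decidable using (isYes≗does)
open import Relation.Binary.PropositionalEquality
open ≡-Reasoning

-- ⨁ f, the sum of f in (Bool, xor, false), is the parity of the number of i with f i.
open import Algebra.Properties.CommutativeMonoid.Sum
  (CommutativeRing.+-commutativeMonoid xor-∧-commutativeRing)
  using ()
  renaming (sum to ⨁; sum-cong-≗ to ⨁-cong; ∑-distrib-+ to ⨁-distrib-xor; ∑-comm to ⨁-comm;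
            ∑-permute to ⨁-permute; sum-replicate-zero to ⨁-false)
open import Algebra.Properties.Group (CommutativeRing.+-group xor-∧-commutativeRing)
  using () renaming (identityˡ-unique to xor-identityˡ-unique)
open import Algebra.Properties.CommutativeMonoid.Sum +-0-commutativeMonoid
  using (sum; ∑-permute; sum-replicate-zero)

-- Parity sums

xor-cancelˡ : ∀ a b → a xor (a xor b) ≡ b
xor-cancelˡ true  b = not-involutive b
xor-cancelˡ false b = refl

⨁² : ∀ {n} → (Fin n → Fin n → Bool) → Bool
⨁² F = ⨁ λ i → ⨁ λ j → F i j

⨁²-cong : ∀ {n} {F G : Fin n → Fin n → Bool} → (∀ i j → F i j ≡ G i j) → ⨁² F ≡ ⨁² G
⨁²-cong F≡G = ⨁-cong λ i → ⨁-cong (F≡G i)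

⨁²-distrib-xor : ∀ {n} (F G : Fin n → Fin n → Bool) →
  ⨁² (λ i j → F i j xor G i j) ≡ ⨁² F xor ⨁² G
⨁²-distrib-xor {n} F G =
  trans (⨁-cong λ i → ⨁-distrib-xor (F i) (G i)) (⨁-distrib-xor {n} _ _)

⨁²-permute : ∀ {n} (F : Fin n → Fin n → Bool) (h : Permutation′ n) →
  ⨁² (λ i j → F (h ⟨$⟩ʳ i) (h ⟨$⟩ʳ j)) ≡ ⨁² F
⨁²-permute F h = sym (trans (⨁-cong λ a → ⨁-permute (F a) h) (⨁-permute _ h))

⨁²-false : ∀ n → ⨁² {n} (λ _ _ → false) ≡ false
⨁²-false n = trans (⨁-cong {n} λ _ → ⨁-false n) (⨁-false n)

odd : ℕ → Bool
odd m = not (even m)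

odd-+ : ∀ m n → odd (m + n) ≡ odd m xor odd n
odd-+ zero    n = refl
odd-+ (suc m) n = trans (cong not (odd-+ m n)) (not-distribˡ-xor (odd m) (odd n))

indicator : Bool → ℕ
indicator b = if b then 1 else 0

odd-indicator : ∀ b → odd (indicator b) ≡ b
odd-indicator true  = refl
odd-indicator false = refl

odd-sumF : ∀ n (f : Fin n → ℕ) → odd (sumF n f) ≡ ⨁ (odd ∘ f)
odd-sumF zero    f = refl
odd-sumF (suc n) f = trans (odd-+ (f 0F) _) (cong (odd (f 0F) xor_) (odd-sumF n (f ∘ suc)))

infix 7 _<ᶠ_
_<ᶠ_ : ∀ {n} → Fin n → Fin n → Bool
i <ᶠ j = toℕ i <ᵇ toℕ j

n<ᵇn : ∀ n → (n <ᵇ n) ≡ false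
n<ᵇn zero    = refl
n<ᵇn (suc n) = n<ᵇn n

<ᵇ-flip : ∀ {m n} → m ≢ n → (n <ᵇ m) ≡ not (m <ᵇ n)
<ᵇ-flip {zero}  {zero}  m≢n = contradiction refl m≢n
<ᵇ-flip {zero}  {suc n} _   = refl
<ᵇ-flip {suc m} {zero}  _   = refl
<ᵇ-flip {suc m} {suc n} m≢n = <ᵇ-flip (m≢n ∘ cong suc)

<ᵇ-asym : ∀ m n → (m <ᵇ n) ∧ (n <ᵇ m) ≡ false
<ᵇ-asym zero    zero    = refl
<ᵇ-asym zero    (suc n) = refl
<ᵇ-asym (suc m) zero    = refl
<ᵇ-asym (suc m) (suc n) = <ᵇ-asym m n

<ᵇ-below : ∀ k {m n} → (m <ᵇ k) ≡ true → (n <ᵇ k) ≡ false → (n <ᵇ m) ≡ false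
<ᵇ-below (suc k) {zero}  {n}     _   _   = refl
<ᵇ-below (suc k) {suc m} {suc n} m<k n≮k = <ᵇ-below k m<k n≮k

≤⇒≮ᵇ : ∀ {m n} → m ≤ n → (n <ᵇ m) ≡ false
≤⇒≮ᵇ z≤n       = refl
≤⇒≮ᵇ (s≤s m≤n) = ≤⇒≮ᵇ m≤n

<ᶠ-irrefl : ∀ {n} (i : Fin n) → (i <ᶠ i) ≡ false
<ᶠ-irrefl i = n<ᵇn (toℕ i)

<ᶠ⇒≢ : ∀ {n} {i j : Fin n} → (i <ᶠ j) ≡ true → i ≢ j
<ᶠ⇒≢ {i = i} i<i refl = contradiction (trans (sym i<i) (<ᶠ-irrefl i)) λ ()

<ᶠ-flip : ∀ {n} {i j : Fin n} → i ≢ j → (j <ᶠ i) ≡ not (i <ᶠ j)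
<ᶠ-flip i≢j = <ᵇ-flip (i≢j ∘ toℕ-injective)

perm-injective : ∀ {n} (π : Permutation′ n) {i j} → π ⟨$⟩ʳ i ≡ π ⟨$⟩ʳ j → i ≡ j
perm-injective π = Injection.injective (↔⇒↣ π)

-- Parity of inversions

-- The order tests come first, so an inversion reduces to false as soon as one of them does.
inversion : ∀ {n} → (Fin n → Bool) → (Fin n → Fin n) → Fin n → Fin n → Bool
inversion P f i j = (f j <ᶠ f i ∧ i <ᶠ j) ∧ P i ∧ P j

parity : ∀ {n} → (Fin n → Bool) → (Fin n → Fin n) → Bool
parity P f = ⨁² (inversion P f)

parity-cong : ∀ {n} (P : Fin n → Bool) {f g : Fin n → Fin n} → f ≗ g → parity P f ≡ parity P g
parity-cong P f≗g = ⨁²-cong λ i j → cong₂ (λ a b → (a <ᶠ b ∧ i <ᶠ j) ∧ P i ∧ P j) (f≗g j) (f≗g i)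

odd-inversionsIn : ∀ {n} (P : Fin n → Bool) (π : Permutation′ n) →
  odd (inversionsIn P π) ≡ parity P (π ⟨$⟩ʳ_)
odd-inversionsIn {n} P π =
  trans (odd-sumF n _) (⨁-cong λ i → trans (odd-sumF n _) (⨁-cong λ j →
    trans (odd-indicator _)
      (trans (cong₂ (λ l r → P i ∧ P j ∧ l ∧ r) (isYes≗does (i <? j)) (isYes≗does (f j <? f i)))
             (reorder (P i) (P j) (i <ᶠ j) (f j <ᶠ f i)))))
  where
  f : Fin n → Fin n
  f = π ⟨$⟩ʳ_
  reorder : ∀ p q l r → p ∧ q ∧ l ∧ r ≡ (r ∧ l) ∧ p ∧ q
  reorder true  true  l r = trans (∧-comm l r) (sym (∧-identityʳ _))
  reorder true  false l r = sym (∧-zeroʳ _)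
  reorder false q     l r = sym (∧-zeroʳ _)

even≡not-parity : ∀ {n} (P : Fin n → Bool) (π : Permutation′ n) →
  even (inversionsIn P π) ≡ not (parity P (π ⟨$⟩ʳ_))
even≡not-parity P π = trans (sym (not-involutive _)) (cong not (odd-inversionsIn P π))

even-inversionsIn⇔ : ∀ {n} (P : Fin n → Bool) (π : Permutation′ n) →
  (even (inversionsIn P π) ≡ true) ⇔ (parity P (π ⟨$⟩ʳ_) ≡ false)
even-inversionsIn⇔ P π = mk⇔
  (λ e → not-injective (trans (sym (even≡not-parity P π)) e))
  (λ e → trans (even≡not-parity P π) (cong not e))

reverses : ∀ {n} → (Fin n → Fin n) → Fin n → Fin n → Bool
reverses f i j = (i <ᶠ j) xor (f i <ᶠ f j)

reverses-refl : ∀ {n} (f : Fin n → Fin n) i → reverses f i i ≡ false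
reverses-refl f i = cong₂ _xor_ (<ᶠ-irrefl i) (<ᶠ-irrefl (f i))

reverses-sym : ∀ {n} (π : Permutation′ n) i j → reverses (π ⟨$⟩ʳ_) i j ≡ reverses (π ⟨$⟩ʳ_) j i
reverses-sym π i j with i ≟ j
... | yes refl = refl
... | no i≢j = sym (trans (cong₂ _xor_ (<ᶠ-flip i≢j) (<ᶠ-flip (i≢j ∘ perm-injective π)))
                          (xor-annihilates-not (i <ᶠ j) ((π ⟨$⟩ʳ i) <ᶠ (π ⟨$⟩ʳ j))))

reverses-∘ : ∀ {n} (g f : Fin n → Fin n) i j →
  reverses (g ∘ f) i j ≡ reverses f i j xor reverses g (f i) (f j)
reverses-∘ g f i j = sym (trans (xor-assoc a b (b xor c)) (cong (a xor_) (xor-cancelˡ b c)))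
  where
  a b c : Bool
  a = i <ᶠ j
  b = f i <ᶠ f j
  c = g (f i) <ᶠ g (f j)

Symmetric : ∀ {n} → (Fin n → Fin n → Bool) → Set
Symmetric S = ∀ i j → S i j ≡ S j i

ascending : ∀ {n} → (Fin n → Fin n → Bool) → Bool
ascending S = ⨁² λ i j → i <ᶠ j ∧ S i j

ascending-xor : ∀ {n} (S T : Fin n → Fin n → Bool) →
  ascending (λ i j → S i j xor T i j) ≡ ascending S xor ascending T
ascending-xor {n} S T =
  trans (⨁²-cong λ i j → ∧-distribˡ-xor (i <ᶠ j) (S i j) (T i j)) (⨁²-distrib-xor {n} _ _)

-- Each off-diagonal pair {i, j} is counted twice.
⨁²-symmetric : ∀ {n} (S : Fin n → Fin n → Bool) → Symmetric S → (∀ i → S i i ≡ false) →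
  ⨁² S ≡ false
⨁²-symmetric {n} S S-sym S-diag = begin
  ⨁² S                        ≡⟨ ⨁²-cong split ⟩
  ⨁² (λ i j → A i j xor A j i) ≡⟨ ⨁²-distrib-xor A (λ i j → A j i) ⟩
  ⨁² A xor ⨁² (λ i j → A j i)  ≡⟨ cong (⨁² A xor_) (sym (⨁-comm A)) ⟩
  ⨁² A xor ⨁² A               ≡⟨ xor-same (⨁² A) ⟩
  false                       ∎
  where
  A : Fin n → Fin n → Bool
  A i j = i <ᶠ j ∧ S i j
  split : ∀ i j → S i j ≡ A i j xor A j i
  split i j with i ≟ j
  ... | yes refl = trans (S-diag i) (sym (xor-same (A i i)))
  ... | no i≢j = begin
    S i j                                  ≡⟨ cong (_∧ S i j) (xor-inverseʳ (i <ᶠ j)) ⟨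
    (i <ᶠ j xor not (i <ᶠ j)) ∧ S i j      ≡⟨ ∧-distribʳ-xor (S i j) (i <ᶠ j) _ ⟩
    A i j xor not (i <ᶠ j) ∧ S i j         ≡⟨ cong₂ (λ l s → A i j xor l ∧ s) (<ᶠ-flip i≢j) (S-sym j i) ⟨
    A i j xor A j i                        ∎

-- The left side is the ascending sum for the order pulled back along π.
ascending-reorder : ∀ {n} (π : Permutation′ n) (S : Fin n → Fin n → Bool) → Symmetric S →
  ⨁² (λ i j → (π ⟨$⟩ʳ i) <ᶠ (π ⟨$⟩ʳ j) ∧ S i j) ≡ ascending S
ascending-reorder {n} π S S-sym = begin
  ⨁² (λ i j → f i <ᶠ f j ∧ S i j)          ≡⟨ ⨁²-cong split ⟩
  ⨁² (λ i j → (i <ᶠ j ∧ S i j) xor D i j)   ≡⟨ ⨁²-distrib-xor _ D ⟩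
  ascending S xor ⨁² D                     ≡⟨ cong (ascending S xor_) D-vanishes ⟩
  ascending S xor false                    ≡⟨ xor-identityʳ _ ⟩
  ascending S                              ∎
  where
  f : Fin n → Fin n
  f = π ⟨$⟩ʳ_
  D : Fin n → Fin n → Bool
  D i j = reverses f i j ∧ S i j
  split : ∀ i j → f i <ᶠ f j ∧ S i j ≡ (i <ᶠ j ∧ S i j) xor D i j
  split i j = trans (cong (_∧ S i j) (sym (xor-cancelˡ (i <ᶠ j) (f i <ᶠ f j))))
                    (∧-distribʳ-xor (S i j) (i <ᶠ j) (reverses f i j))
  D-vanishes : ⨁² D ≡ false
  D-vanishes = ⨁²-symmetric D (λ i j → cong₂ _∧_ (reverses-sym π i j) (S-sym i j))
                              (λ i → cong (_∧ S i i) (reverses-refl f i))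

ascending-permute : ∀ {n} (h : Permutation′ n) (S : Fin n → Fin n → Bool) → Symmetric S →
  ascending (λ i j → S (h ⟨$⟩ʳ i) (h ⟨$⟩ʳ j)) ≡ ascending S
ascending-permute h S S-sym =
  trans (sym (ascending-reorder h _ (λ i j → S-sym (h ⟨$⟩ʳ i) (h ⟨$⟩ʳ j))))
        (⨁²-permute (λ a b → a <ᶠ b ∧ S a b) h)

parity-ascending : ∀ {n} (P : Fin n → Bool) (π : Permutation′ n) →
  parity P (π ⟨$⟩ʳ_) ≡ ascending (λ i j → reverses (π ⟨$⟩ʳ_) i j ∧ P i ∧ P j)
parity-ascending {n} P π = ⨁²-cong pointwise
  where
  f : Fin n → Fin n
  f = π ⟨$⟩ʳ_
  pointwise : ∀ i j → inversion P f i j ≡ i <ᶠ j ∧ reverses f i j ∧ P i ∧ P j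
  pointwise i j with i <ᶠ j in i<j
  ... | false = cong (_∧ P i ∧ P j) (∧-zeroʳ (f j <ᶠ f i))
  ... | true  =
    cong (_∧ P i ∧ P j) (trans (∧-identityʳ _) (<ᶠ-flip (<ᶠ⇒≢ i<j ∘ perm-injective π)))

Stabilises : ∀ {n} → (Fin n → Bool) → Permutation′ n → Set
Stabilises P π = ∀ i → P (π ⟨$⟩ʳ i) ≡ P i

parity-∘ₚ : ∀ {n} (P : Fin n → Bool) (h g : Permutation′ n) → Stabilises P h →
  parity P ((h ∘ₚ g) ⟨$⟩ʳ_) ≡ parity P (h ⟨$⟩ʳ_) xor parity P (g ⟨$⟩ʳ_)
parity-∘ₚ {n} P h g h-stab = begin
  parity P ((h ∘ₚ g) ⟨$⟩ʳ_)
    ≡⟨ parity-ascending P (h ∘ₚ g) ⟩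
  ascending (B (h ∘ₚ g))
    ≡⟨ ⨁²-cong (λ i j → cong (i <ᶠ j ∧_) (split i j)) ⟩
  ascending (λ i j → B h i j xor B g (ĥ i) (ĥ j))
    ≡⟨ ascending-xor (B h) _ ⟩
  ascending (B h) xor ascending (λ i j → B g (ĥ i) (ĥ j))
    ≡⟨ cong (ascending (B h) xor_) (ascending-permute h (B g) (B-sym g)) ⟩
  ascending (B h) xor ascending (B g)
    ≡⟨ cong₂ _xor_ (parity-ascending P h) (parity-ascending P g) ⟨
  parity P ĥ xor parity P ĝ
    ∎
  where
  ĥ ĝ : Fin n → Fin n
  ĥ = h ⟨$⟩ʳ_
  ĝ = g ⟨$⟩ʳ_
  B : Permutation′ n → Fin n → Fin n → Bool
  B π i j = reverses (π ⟨$⟩ʳ_) i j ∧ P i ∧ P j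
  B-sym : ∀ π → Symmetric (B π)
  B-sym π i j = cong₂ _∧_ (reverses-sym π i j) (∧-comm (P i) (P j))
  split : ∀ i j → B (h ∘ₚ g) i j ≡ B h i j xor B g (ĥ i) (ĥ j)
  split i j = begin
    reverses (ĝ ∘ ĥ) i j ∧ P i ∧ P j
      ≡⟨ cong (_∧ P i ∧ P j) (reverses-∘ ĝ ĥ i j) ⟩
    (reverses ĥ i j xor reverses ĝ (ĥ i) (ĥ j)) ∧ P i ∧ P j
      ≡⟨ ∧-distribʳ-xor (P i ∧ P j) (reverses ĥ i j) (reverses ĝ (ĥ i) (ĥ j)) ⟩
    B h i j xor reverses ĝ (ĥ i) (ĥ j) ∧ P i ∧ P j
      ≡⟨ cong₂ (λ p q → B h i j xor reverses ĝ (ĥ i) (ĥ j) ∧ p ∧ q) (h-stab i) (h-stab j) ⟨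
    B h i j xor B g (ĥ i) (ĥ j)
      ∎

parity-quotient : ∀ {n} (P : Fin n → Bool) (x y : Permutation′ n) → Stabilises P (y ∘ₚ flip x) →
  parity P (y ⟨$⟩ʳ_) ≡ parity P ((y ∘ₚ flip x) ⟨$⟩ʳ_) xor parity P (x ⟨$⟩ʳ_)
parity-quotient P x y stab =
  trans (parity-cong P (λ i → sym (inverseʳ x))) (parity-∘ₚ P (y ∘ₚ flip x) x stab)

-- An initial segment can only be stabilised if no pair straddling it is inverted.
parity-low-split : ∀ {n} k (π : Permutation′ n) → Stabilises (low k) π →
  parity (λ _ → true) (π ⟨$⟩ʳ_) ≡ parity (low k) (π ⟨$⟩ʳ_) xor parity (not ∘ low k) (π ⟨$⟩ʳ_)
parity-low-split {n} k π stab =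
  trans (⨁²-cong pointwise) (⨁²-distrib-xor (inversion (low k) f) (inversion (not ∘ low k) f))
  where
  f : Fin n → Fin n
  f = π ⟨$⟩ʳ_
  pointwise : ∀ i j →
    inversion (λ _ → true) f i j ≡ inversion (low k) f i j xor inversion (not ∘ low k) f i j
  pointwise i j with low k i in li | low k j in lj
  ... | true  | true  = sym (trans (cong (x ∧ true xor_) (∧-zeroʳ x)) (xor-identityʳ (x ∧ true)))
    where x : Bool
          x = f j <ᶠ f i ∧ i <ᶠ j
  ... | false | false = sym (cong (_xor x ∧ true) (∧-zeroʳ x))
    where x : Bool
          x = f j <ᶠ f i ∧ i <ᶠ j
  ... | true  | false rewrite <ᵇ-below k (trans (stab i) li) (trans (stab j) lj) = refl
  ... | false | true  rewrite <ᵇ-below k lj li | ∧-zeroʳ (f j <ᶠ f i) = refl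

parity-lift₀ : ∀ {n} (P : Fin (suc n) → Bool) (ρ : Permutation′ n) →
  parity P (lift₀ ρ ⟨$⟩ʳ_) ≡ parity (P ∘ suc) (ρ ⟨$⟩ʳ_)
parity-lift₀ {n} P ρ = cong (_xor parity (P ∘ suc) (ρ ⟨$⟩ʳ_)) (⨁-false (suc n))

stabilises-lift₀ : ∀ {n} (P : Fin (suc n) → Bool) (ρ : Permutation′ n) →
  Stabilises (P ∘ suc) ρ → Stabilises P (lift₀ ρ)
stabilises-lift₀ P ρ stab zero    = refl
stabilises-lift₀ P ρ stab (suc i) = stab i

raiseₚ : ∀ {m} k → Permutation′ m → Permutation′ (k + m)
raiseₚ zero    σ = σ
raiseₚ (suc k) σ = lift₀ (raiseₚ k σ)

parity-raiseₚ : ∀ {m} k (P : Fin (k + m) → Bool) (σ : Permutation′ m) →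
  parity P (raiseₚ k σ ⟨$⟩ʳ_) ≡ parity (P ∘ (k ↑ʳ_)) (σ ⟨$⟩ʳ_)
parity-raiseₚ zero    P σ = refl
parity-raiseₚ (suc k) P σ = trans (parity-lift₀ P (raiseₚ k σ)) (parity-raiseₚ k (P ∘ suc) σ)

stabilises-raiseₚ : ∀ {m} k (P : Fin (k + m) → Bool) (σ : Permutation′ m) →
  Stabilises (P ∘ (k ↑ʳ_)) σ → Stabilises P (raiseₚ k σ)
stabilises-raiseₚ zero    P σ stab = stab
stabilises-raiseₚ (suc k) P σ stab =
  stabilises-lift₀ P (raiseₚ k σ) (stabilises-raiseₚ k (P ∘ suc) σ stab)

low-↑ʳ : ∀ k {m} (i : Fin m) → low k (k ↑ʳ i) ≡ false
low-↑ʳ zero    i = refl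
low-↑ʳ (suc k) i = low-↑ʳ k i

parity-transpose01 : ∀ {n} (P : Fin (2 + n) → Bool) →
  parity P (transpose 0F 1F ⟨$⟩ʳ_) ≡ P 0F ∧ P 1F
-- Unfolded, the sum has a row and a column for each of 0 and 1;
-- of those entries only (0, 1) is an inversion.
parity-transpose01 {n} P = begin
  ((P 0F ∧ P 1F) xor ⨁ (λ (_ : Fin n) → false)) xor (⨁ (λ (_ : Fin n) → false) xor ⨁² rest)
    ≡⟨ cong₂ (λ z r → ((P 0F ∧ P 1F) xor z) xor (z xor r)) (⨁-false n) rest≡false ⟩
  ((P 0F ∧ P 1F) xor false) xor false
    ≡⟨ trans (xor-identityʳ _) (xor-identityʳ _) ⟩
  P 0F ∧ P 1F ∎
  where
  rest : Fin n → Fin n → Bool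
  rest x y = inversion P (transpose 0F 1F ⟨$⟩ʳ_) (suc (suc x)) (suc (suc y))
  rest≡false : ⨁² rest ≡ false
  rest≡false = trans (⨁²-cong λ x y → cong (_∧ P (suc (suc x)) ∧ P (suc (suc y)))
                                            (<ᵇ-asym (toℕ y) (toℕ x)))
                     (⨁²-false n)

-- The k-set U

U-∘ₚ : ∀ {n} k (τ z : Permutation′ n) → Stabilises (low k) τ → U k (τ ∘ₚ z) ≡ U k z
U-∘ₚ k τ z stab = tabulate-cong λ j → trans (sym (stab _)) (cong (low k) (inverseʳ τ))

U-quotient : ∀ {n} k (x y : Permutation′ n) → Stabilises (low k) (y ∘ₚ flip x) → U k y ≡ U k x
U-quotient k x y stab =
  tabulate-cong λ j → trans (sym (stab (y ⟨$⟩ˡ j))) (cong (low k ∘ (x ⟨$⟩ˡ_)) (inverseʳ y))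

∣tabulate∣ : ∀ {n} (f : Fin n → Bool) → ∣ tabulate f ∣ ≡ sum (indicator ∘ f)
∣tabulate∣ {zero}  f = refl
∣tabulate∣ {suc n} f with f zero
... | true  = cong suc (∣tabulate∣ (f ∘ suc))
... | false = ∣tabulate∣ (f ∘ suc)

count-low : ∀ {n k} → k ≤ n → sum (indicator ∘ low {n} k) ≡ k
count-low {zero}  z≤n       = refl
count-low {suc n} z≤n       = sum-replicate-zero (suc n)
count-low {suc n} (s≤s k≤n) = cong suc (count-low k≤n)

∣U∣≡k : ∀ {n} k → k ≤ n → (x : Permutation′ n) → ∣ U k x ∣ ≡ k
∣U∣≡k k k≤n x =
  trans (∣tabulate∣ (λ j → low k (x ⟨$⟩ˡ j)))
        (trans (sym (∑-permute (indicator ∘ low k) (flip x))) (count-low k≤n))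

toℕ-punchIn-fromℕ : ∀ n (i : Fin n) → toℕ (punchIn (fromℕ n) i) ≡ toℕ i
toℕ-punchIn-fromℕ (suc n) zero    = refl
toℕ-punchIn-fromℕ (suc n) (suc i) = cong suc (toℕ-punchIn-fromℕ n i)

frontload : ∀ {n} → Subset n → Permutation′ n
frontload []                  = id
frontload (true ∷ S)          = lift₀ (frontload S)
frontload {suc n} (false ∷ S) = insert zero (fromℕ n) (frontload S)

low-frontload : ∀ {n} (S : Subset n) j → low ∣ S ∣ (frontload S ⟨$⟩ʳ j) ≡ lookup S j
low-frontload (true ∷ S) zero    = refl
low-frontload (true ∷ S) (suc j) = low-frontload S j
low-frontload {suc n} (false ∷ S) zero rewrite toℕ-fromℕ n = ≤⇒≮ᵇ (∣p∣≤n S)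
low-frontload {suc n} (false ∷ S) (suc j)
  rewrite toℕ-punchIn-fromℕ n (frontload S ⟨$⟩ʳ j) = low-frontload S j

U-flip-frontload : ∀ {n} (S : Subset n) → U ∣ S ∣ (flip (frontload S)) ≡ S
U-flip-frontload S = trans (tabulate-cong (low-frontload S)) (tabulate∘lookup S)

-- Cosets of Alt(k) × Alt(n − k)

adjust : ∀ {n} → Bool → Permutation′ n → Permutation′ n → Permutation′ n
adjust false τ z = z
adjust true  τ z = τ ∘ₚ z

parity-adjust : ∀ {n} (P : Fin n → Bool) (τ : Permutation′ n) → Stabilises P τ → ∀ b z →
  parity P (adjust b τ z ⟨$⟩ʳ_) ≡ (b ∧ parity P (τ ⟨$⟩ʳ_)) xor parity P (z ⟨$⟩ʳ_)
parity-adjust P τ stab false z = refl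
parity-adjust P τ stab true  z = parity-∘ₚ P τ z stab

parity-adjust-odd : ∀ {n} (P : Fin n → Bool) (τ : Permutation′ n) → Stabilises P τ →
  parity P (τ ⟨$⟩ʳ_) ≡ true → ∀ a z → parity P (adjust (a xor parity P (z ⟨$⟩ʳ_)) τ z ⟨$⟩ʳ_) ≡ a
parity-adjust-odd P τ stab τ-odd a z = begin
  parity P (adjust (a xor p) τ z ⟨$⟩ʳ_) ≡⟨ parity-adjust P τ stab (a xor p) z ⟩
  ((a xor p) ∧ parity P (τ ⟨$⟩ʳ_)) xor p ≡⟨ cong (λ t → ((a xor p) ∧ t) xor p) τ-odd ⟩
  ((a xor p) ∧ true) xor p              ≡⟨ cong (_xor p) (∧-identityʳ (a xor p)) ⟩
  (a xor p) xor p                       ≡⟨ xor-assoc a p p ⟩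
  a xor (p xor p)                       ≡⟨ cong (a xor_) (xor-same p) ⟩
  a xor false                           ≡⟨ xor-identityʳ a ⟩
  a                                     ∎
  where p : Bool
        p = parity P (z ⟨$⟩ʳ_)

parity-adjust-even : ∀ {n} (P : Fin n → Bool) (τ : Permutation′ n) → Stabilises P τ →
  parity P (τ ⟨$⟩ʳ_) ≡ false → ∀ b z → parity P (adjust b τ z ⟨$⟩ʳ_) ≡ parity P (z ⟨$⟩ʳ_)
parity-adjust-even P τ stab τ-even b z =
  trans (parity-adjust P τ stab b z)
        (cong (_xor parity P (z ⟨$⟩ʳ_)) (trans (cong (b ∧_) τ-even) (∧-zeroʳ b)))

U-adjust : ∀ {n} k (τ : Permutation′ n) → Stabilises (low k) τ → ∀ b z → U k (adjust b τ z) ≡ U k z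
U-adjust k τ stab false z = refl
U-adjust k τ stab true  z = U-∘ₚ k τ z stab

module _ (k′ r : ℕ) where
  private
    k n : ℕ
    k = 2 + k′
    n = k + (2 + r)

    L : Fin n → Bool
    L = low k

    full : Fin n → Bool
    full _ = true

  totalParity lowParity : Permutation′ n → Bool
  totalParity x = parity full (x ⟨$⟩ʳ_)
  lowParity   x = parity L (x ⟨$⟩ʳ_)

  sameCoset⇒ : ∀ {x y} → SameCoset k x y →
    totalParity x ≡ totalParity y × lowParity x ≡ lowParity y × U k x ≡ U k y
  sameCoset⇒ {x} {y} (stab , evenL , evenR) =
    sym (invariant full (λ _ → refl) h-evenFull) ,
    sym (invariant L stab h-evenL) ,
    sym (U-quotient k x y stab)
    where
    h : Permutation′ n
    h = y ∘ₚ flip x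
    h-evenL : parity L (h ⟨$⟩ʳ_) ≡ false
    h-evenL = Equivalence.to (even-inversionsIn⇔ L h) evenL
    h-evenFull : parity full (h ⟨$⟩ʳ_) ≡ false
    h-evenFull = trans (parity-low-split k h stab)
      (cong₂ _xor_ h-evenL (Equivalence.to (even-inversionsIn⇔ (not ∘ L) h) evenR))
    invariant : ∀ P → Stabilises P h → parity P (h ⟨$⟩ʳ_) ≡ false →
                parity P (y ⟨$⟩ʳ_) ≡ parity P (x ⟨$⟩ʳ_)
    invariant P h-stab h-even =
      trans (parity-quotient P x y h-stab) (cong (_xor parity P (x ⟨$⟩ʳ_)) h-even)

  ⇒sameCoset : ∀ x y → totalParity x ≡ totalParity y → lowParity x ≡ lowParity y → U k x ≡ U k y →
    SameCoset k x y
  ⇒sameCoset x y full≡ L≡ U≡ =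
    stab ,
    Equivalence.from (even-inversionsIn⇔ L h) h-evenL ,
    Equivalence.from (even-inversionsIn⇔ (not ∘ L) h) h-evenR
    where
    h : Permutation′ n
    h = y ∘ₚ flip x
    stab : Stabilises L h
    stab i = begin
      L (x ⟨$⟩ˡ (y ⟨$⟩ʳ i))         ≡⟨ lookup∘tabulate (L ∘ (x ⟨$⟩ˡ_)) (y ⟨$⟩ʳ i) ⟨
      lookup (U k x) (y ⟨$⟩ʳ i)     ≡⟨ cong (λ v → lookup v (y ⟨$⟩ʳ i)) U≡ ⟩
      lookup (U k y) (y ⟨$⟩ʳ i)     ≡⟨ lookup∘tabulate (L ∘ (y ⟨$⟩ˡ_)) (y ⟨$⟩ʳ i) ⟩
      L (y ⟨$⟩ˡ (y ⟨$⟩ʳ i))         ≡⟨ cong L (inverseˡ y) ⟩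
      L i                           ∎
    h-even : ∀ P → Stabilises P h → parity P (x ⟨$⟩ʳ_) ≡ parity P (y ⟨$⟩ʳ_) → parity P (h ⟨$⟩ʳ_) ≡ false
    h-even P h-stab x≡y = xor-identityˡ-unique _ _ (sym (trans x≡y (parity-quotient P x y h-stab)))
    h-evenL : parity L (h ⟨$⟩ʳ_) ≡ false
    h-evenL = h-even L stab L≡
    h-evenR : parity (not ∘ L) (h ⟨$⟩ʳ_) ≡ false
    h-evenR = sym (trans (sym (h-even full (λ _ → refl) full≡))
                         (trans (parity-low-split k h stab)
                                (cong (_xor parity (not ∘ L) (h ⟨$⟩ʳ_)) h-evenL)))

  -- τ₁ and τ₂ fix U; τ₁ changes both parities, τ₂ only the total one.
  τ₁ τ₂ : Permutation′ n
  τ₁ = transpose 0F 1F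
  τ₂ = raiseₚ k (transpose 0F 1F)

  τ₁-stab : Stabilises L τ₁
  τ₁-stab zero          = refl
  τ₁-stab (suc zero)    = refl
  τ₁-stab (suc (suc i)) = refl

  τ₁-oddL : lowParity τ₁ ≡ true
  τ₁-oddL = parity-transpose01 L

  τ₂-stab : Stabilises L τ₂
  τ₂-stab = stabilises-raiseₚ k L (transpose 0F 1F) λ i → trans (low-↑ʳ k _) (sym (low-↑ʳ k i))

  τ₂-odd : totalParity τ₂ ≡ true
  τ₂-odd = trans (parity-raiseₚ k full (transpose 0F 1F)) (parity-transpose01 (full ∘ (k ↑ʳ_)))

  τ₂-evenL : lowParity τ₂ ≡ false
  τ₂-evenL = trans (parity-raiseₚ k L (transpose 0F 1F))
    (trans (parity-transpose01 (L ∘ (k ↑ʳ_))) (cong (_∧ L (k ↑ʳ 1F)) (low-↑ʳ k (zero {suc r}))))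

  fixLowParity : Bool → Permutation′ n → Permutation′ n
  fixLowParity l z = adjust (l xor lowParity z) τ₁ z

  fixTotalParity : Bool → Permutation′ n → Permutation′ n
  fixTotalParity t z = adjust (t xor totalParity z) τ₂ z

  realise : Bool → Bool → Subset n → Permutation′ n
  realise t l S = fixTotalParity t (fixLowParity l (flip (frontload S)))

  realise-spec : ∀ t l (S : Subset n) → ∣ S ∣ ≡ k →
    totalParity (realise t l S) ≡ t × lowParity (realise t l S) ≡ l × U k (realise t l S) ≡ S
  realise-spec t l S ∣S∣≡k = total≡ , low≡ , U≡
    where
    z₀ z₁ : Permutation′ n
    z₀ = flip (frontload S)
    z₁ = fixLowParity l z₀
    total≡ : totalParity (realise t l S) ≡ t
    total≡ = parity-adjust-odd full τ₂ (λ _ → refl) τ₂-odd t z₁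
    low≡ : lowParity (realise t l S) ≡ l
    low≡ = trans (parity-adjust-even L τ₂ τ₂-stab τ₂-evenL (t xor totalParity z₁) z₁)
                 (parity-adjust-odd L τ₁ τ₁-stab τ₁-oddL l z₀)
    U≡ : U k (realise t l S) ≡ S
    U≡ = trans (U-adjust k τ₂ τ₂-stab (t xor totalParity z₁) z₁)
               (trans (U-adjust k τ₁ τ₁-stab (l xor lowParity z₀) z₀)
                      (subst (λ m → U m z₀ ≡ S) ∣S∣≡k (U-flip-frontload S)))

  realise-invariants : ∀ x → SameCoset k (realise (totalParity x) (lowParity x) (U k x)) x
  realise-invariants x =
    let t≡ , l≡ , U≡ = realise-spec (totalParity x) (lowParity x) (U k x) (∣U∣≡k k (m≤m+n k (2 + r)) x)
    in ⇒sameCoset (realise (totalParity x) (lowParity x) (U k x)) x t≡ l≡ U≡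

  sgn≡⇔totalParity≡ : ∀ x y → (sgn x ≡ sgn y) ⇔ (totalParity x ≡ totalParity y)
  sgn≡⇔totalParity≡ x y = mk⇔
    (λ e → not-injective (trans (sym (even≡not-parity full x)) (trans e (even≡not-parity full y))))
    (λ e → trans (even≡not-parity full x) (trans (cong not e) (sym (even≡not-parity full y))))

  iso : 𝒦 n k ≅ TwoCopies (K₂⋈ (KneserGraph n k))
  iso = record
    { to        = λ x → totalParity x , lowParity x , U k x , ∣U∣≡k k (m≤m+n k (2 + r)) x
    ; from      = λ { (t , l , S , _) → realise t l S }
    ; to-cong   = λ {x} {y} → sameCoset⇒ {x} {y}
    ; from-cong = λ { {t , l , S , _} {.t , .l , .S , _} (refl , refl , refl) →
                    ⇒sameCoset (realise t l S) (realise t l S) refl refl refl }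
    ; from∘to   = realise-invariants
    ; to∘from   = λ { (t , l , S , ∣S∣≡k) → realise-spec t l S ∣S∣≡k }
    ; adj⇔      = λ x y → let open Equivalence (sgn≡⇔totalParity≡ x y) in
                  mk⇔ (λ (disjoint , sgn≡) → to sgn≡ , disjoint)
                      (λ (parity≡ , disjoint) → disjoint , from parity≡)
    }

𝒦≅TwoCopies-K₂⋈Kneser : ∀ {n k} → 2 ≤ k → k + 2 ≤ n → 𝒦 n k ≅ TwoCopies (K₂⋈ (KneserGraph n k))
𝒦≅TwoCopies-K₂⋈Kneser {k = suc (suc k′)} (s≤s (s≤s z≤n)) k+2≤n with m≤n⇒∃[o]m+o≡n k+2≤n
... | r , refl = subst (λ m → 𝒦 m (2 + k′) ≅ TwoCopies (K₂⋈ (KneserGraph m (2 + k′))))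
                       (sym (+-assoc (2 + k′) 2 r)) (iso k′ r)

proposition7p3 : (n k : ℕ) → 3 ≤ k → 2 * k + 2 ≤ n →
    𝒦 n k ≅ TwoCopies (K₂⋈ (KneserGraph n k))
proposition7p3 n k 3≤k 2k+2≤n =
  𝒦≅TwoCopies-K₂⋈Kneser (≤-trans (n≤1+n 2) 3≤k) (≤-trans (+-monoˡ-≤ 2 (m≤m+n k (k + 0))) 2k+2≤n)
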